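{- Let $N$ be a neuron, $id,len\in\mathbb{N}$, and suppose $\mathit{One\_input}(N,id,len)$ and that $N$ is initial. Then for every list $\mathit{inp}=[f_1;\dots;f_k]$ of input functions, the number of occurrences of $1$ in $Output_N(\mathit{inp},len)$ is at most the number of occurrences of $1$ in $[f_1(id);\dots;f_k(id)]$.
   Context: Booleans are identified with $0$ (false) and $1$ (true). A neuron $N$ consists of an identifier $id_N\in\mathbb{N}$, a weight function $w_N:\mathbb{N}\to\mathbb{Q}$ with $-1\le w_N(x)\le 1$ for all $x$ and $w_N(id_N)=0$, a leak factor $lk_N\in\mathbb{Q}$ with $0\le lk_N\le 1$, a threshold $\tau_N\in\mathbb{Q}$ with $\tau_N>0$, an output list $Output(N)$ of booleans (most recent first) and a current potential $CurPot(N)\in\mathbb{Q}$, subject to: $(\tau_N\le CurPot(N))$ equals the head of $Output(N)$ (the head of an empty list being $0$). An input function is a map $i:\mathbb{N}\to\{0,1\}$; $potential(w,i,len)=\sum_{0\le k<len,\ i(k)=1} w(k)$. The one-step update of $N$ with input function $i$ in an environment of $len$ neurons keeps $id,w,lk,\tau$, sets the new potential $p=potential(w_N,i,len)$ if $\tau_N\le CurPot(N)$ and $p=potential(w_N,i,len)+lk_N\cdot CurPot(N)$ otherwise, and sets the new output list to $(\tau_N\le p)::Output(N)$. For a list of input functions (most recent first), $AfterNsteps(N,[\,],len)=N$ and $AfterNsteps(N,i::\mathit{inp},len)$ is the one-step update of $AfterNsteps(N,\mathit{inp},len)$ with $i$; $Output_N(\mathit{inp},len)$ denotes its output list. $N$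 is initial if $Output(N)=[0]$ and $CurPot(N)=0$. $\mathit{One\_input}(N,id,len)$ means $id<len$ and $w_N(id')=0$ for all $id'\neq id$ with $id'<len$. -}

module Defs where

open import Data.Nat using (ℕ; zero; suc) renaming (_<_ to _<ℕ_)
open import Data.Bool using (Bool; true; false; if_then_else_)
open import Data.List using (List; []; _∷_; map)
open import Data.Product using (_×_)
open import Data.Rational using (ℚ; 0ℚ; 1ℚ; -_; _+_; _*_; _≤_; _<_; _≤ᵇ_)
open import Data.Empty using (⊥)
open import Relation.Binary.PropositionalEquality using (_≡_; refl)

-- Booleans: false = 0, true = 1.

headB : List Bool → Bool
headB []      = false
headB (b ∷ _) = b

record Neuron : Set where
  field
    nid     : ℕ
    w       : ℕ → ℚ
    w-lo    : ∀ x → - 1ℚ ≤ w x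
    w-hi    : ∀ x → w x ≤ 1ℚ
    w-self  : w nid ≡ 0ℚ
    lk      : ℚ
    lk-lo   : 0ℚ ≤ lk
    lk-hi   : lk ≤ 1ℚ
    τ       : ℚ
    τ-pos   : 0ℚ < τ
    Output  : List Bool
    CurPot  : ℚ
    inv     : (τ ≤ᵇ CurPot) ≡ headB Output

open Neuron public

InputFn : Set
InputFn = ℕ → Bool

potential : (ℕ → ℚ) → InputFn → ℕ → ℚ
potential w i zero    = 0ℚ
potential w i (suc k) = potential w i k + (if i k then w k else 0ℚ)

nextPot : Neuron → InputFn → ℕ → ℚ
nextPot N i len =
  if τ N ≤ᵇ CurPot N
  then potential (w N) i len
  else potential (w N) i len + lk N * CurPot N

NextNeuron : Neuron → InputFn → ℕ → Neuron
NextNeuron N i len = record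
  { nid = nid N ; w = w N ; w-lo = w-lo N ; w-hi = w-hi N ; w-self = w-self N
  ; lk = lk N ; lk-lo = lk-lo N ; lk-hi = lk-hi N
  ; τ = τ N ; τ-pos = τ-pos N
  ; Output = (τ N ≤ᵇ nextPot N i len) ∷ Output N
  ; CurPot = nextPot N i len
  ; inv = refl }

-- input lists are most recent first
AfterNsteps : Neuron → List InputFn → ℕ → Neuron
AfterNsteps N []        len = N
AfterNsteps N (i ∷ inp) len = NextNeuron (AfterNsteps N inp len) i len

OutputN : Neuron → List InputFn → ℕ → List Bool
OutputN N inp len = Output (AfterNsteps N inp len)

IsInitial : Neuron → Set
IsInitial N = (Output N ≡ false ∷ []) × (CurPot N ≡ 0ℚ)

One-input : Neuron → ℕ → ℕ → Set
One-input N id len = (id <ℕ len) × (∀ id' → (id' ≡ id → ⊥) → id' <ℕ len → w N id' ≡ 0ℚ)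

count1 : List Bool → ℕ
count1 []          = 0
count1 (true ∷ bs)  = suc (count1 bs)
count1 (false ∷ bs) = count1 bs

{-# OPTIONS --safe #-}
module Submission where

-- When the input at id is 0, the weighted input is 0, since id is the only input with
-- non-zero weight.  The new potential is then 0 after a firing step, and lk · CurPot with
-- CurPot < τ otherwise; as 0 ≤ lk ≤ 1 and τ > 0 it stays below τ, so the neuron is silent.
-- Thus each output 1 is matched by a 1 at id in the same step, and the initial output is 0.

open import Defs
open import Data.Nat using (ℕ; _≤_; zero; suc; s≤s) renaming (_<_ to _<ℕ_)
open import Data.Nat.Properties using (_≟_; n<1+n; m≤n⇒m≤1+n; ≤-reflexive)
open import Data.List using (List; map; []; _∷_)
open import Data.Bool using (Bool; true; false; T; if_then_else_; b≤b; f≤t) renaming (_≤_ to _≤𝔹_)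
open import Data.Bool.Properties using (≤-maximum)
open import Data.Product using (_,_)
open import Data.Sum using (inj₁; inj₂)
open import Relation.Binary.PropositionalEquality using (_≡_; refl; sym; trans; cong; cong₂; subst)
open import Relation.Nullary using (yes; no; contradiction)
open import Data.Rational using (ℚ; 0ℚ; 1ℚ; _+_; _*_; _<_; _≤ᵇ_; nonNegative)
  renaming (_≤_ to _≤ℚ_)
open import Data.Rational.Properties
  using (≤ᵇ⇒≤; ≤⇒≤ᵇ; <-irrefl; <-≤-trans; ≰⇒>; ≤-total; *-monoʳ-≤-nonNeg; *-monoˡ-≤-nonNeg;
         *-identityˡ; *-zeroʳ; +-identityˡ; module ≤-Reasoning)

<⇒≤ᵇ≡false : ∀ {p q} → q < p → (p ≤ᵇ q) ≡ false
<⇒≤ᵇ≡false {p} {q} q<p with p ≤ᵇ q in p≤ᵇq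
... | true  = contradiction (<-≤-trans q<p (≤ᵇ⇒≤ (subst T (sym p≤ᵇq) _))) (<-irrefl refl)
... | false = refl

≤ᵇ≡false⇒> : ∀ {p q} → (p ≤ᵇ q) ≡ false → q < p
≤ᵇ≡false⇒> p≰ᵇq = ≰⇒> (λ p≤q → subst T p≰ᵇq (≤⇒≤ᵇ p≤q))

0≤p≤1⇒p*q<r : ∀ {p q r} → 0ℚ ≤ℚ p → p ≤ℚ 1ℚ → 0ℚ < r → q < r → p * q < r
0≤p≤1⇒p*q<r {p} {q} {r} 0≤p p≤1 0<r q<r with ≤-total 0ℚ q
... | inj₁ 0≤q = begin-strict
  p * q   ≤⟨ *-monoʳ-≤-nonNeg q {{nonNegative 0≤q}} p≤1 ⟩
  1ℚ * q  ≡⟨ *-identityˡ q ⟩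
  q       <⟨ q<r ⟩
  r       ∎
  where open ≤-Reasoning
... | inj₂ q≤0 = begin-strict
  p * q   ≤⟨ *-monoˡ-≤-nonNeg p {{nonNegative 0≤p}} q≤0 ⟩
  p * 0ℚ  ≡⟨ *-zeroʳ p ⟩
  0ℚ      <⟨ 0<r ⟩
  r       ∎
  where open ≤-Reasoning

potential≡0 : ∀ (v : ℕ → ℚ) (i : InputFn) n →
              (∀ k → k <ℕ n → i k ≡ true → v k ≡ 0ℚ) → potential v i n ≡ 0ℚ
potential≡0 v i zero    _      = refl
potential≡0 v i (suc n) active⇒0 =
  cong₂ _+_ (potential≡0 v i n (λ k k<n → active⇒0 k (m≤n⇒m≤1+n k<n))) last≡0
  where
  last≡0 : (if i n then v n else 0ℚ) ≡ 0ℚ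
  last≡0 with i n in active
  ... | true  = active⇒0 n (n<1+n n) active
  ... | false = refl

fires : Neuron → InputFn → ℕ → Bool
fires N i len = τ N ≤ᵇ nextPot N i len

One-input⇒potential≡0 : ∀ N {id len} (i : InputFn) → One-input N id len → i id ≡ false →
                        potential (w N) i len ≡ 0ℚ
One-input⇒potential≡0 N {id} {len} i (_ , others≡0) id-inactive =
  potential≡0 (w N) i len active⇒0
  where
  active⇒0 : ∀ k → k <ℕ len → i k ≡ true → w N k ≡ 0ℚ
  active⇒0 k k<len active with k ≟ id
  ... | yes refl = contradiction (trans (sym active) id-inactive) λ ()
  ... | no k≢id  = others≡0 k k≢id k<len

potential≡0⇒¬fires : ∀ N (i : InputFn) len → potential (w N) i len ≡ 0ℚ → fires N i len ≡ false
potential≡0⇒¬fires N i len pot≡0 with τ N ≤ᵇ CurPot N in fired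
... | true  rewrite pot≡0 = <⇒≤ᵇ≡false (τ-pos N)
... | false rewrite pot≡0 | +-identityˡ (lk N * CurPot N) =
  <⇒≤ᵇ≡false (0≤p≤1⇒p*q<r (lk-lo N) (lk-hi N) (τ-pos N) (≤ᵇ≡false⇒> fired))

fires≤input : ∀ N {id len} (i : InputFn) → One-input N id len → fires N i len ≤𝔹 i id
fires≤input N {id} {len} i one-input with i id in id-active
... | true  = ≤-maximum _
... | false
  rewrite potential≡0⇒¬fires N i len (One-input⇒potential≡0 N i one-input id-active) = b≤b

One-input-AfterNsteps : ∀ {N id len} inp → One-input N id len → One-input (AfterNsteps N inp len) id len
One-input-AfterNsteps []        one-input = one-input
One-input-AfterNsteps (_ ∷ inp) one-input = One-input-AfterNsteps inp one-input

count1-mono-∷ : ∀ {b c bs cs} → b ≤𝔹 c → count1 bs ≤ count1 cs → count1 (b ∷ bs) ≤ count1 (c ∷ cs)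
count1-mono-∷ {true}  b≤b bs≤cs = s≤s bs≤cs
count1-mono-∷ {false} b≤b bs≤cs = bs≤cs
count1-mono-∷         f≤t bs≤cs = m≤n⇒m≤1+n bs≤cs

proposition4p11 : (N : Neuron) (id len : ℕ) → One-input N id len → IsInitial N →
    (inp : List InputFn) → count1 (OutputN N inp len) ≤ count1 (map (λ f → f id) inp)
proposition4p11 N id len one-input (output≡[0] , _) [] = ≤-reflexive (cong count1 output≡[0])
proposition4p11 N id len one-input initial (i ∷ inp) =
  count1-mono-∷ {bs = OutputN N inp len} {cs = map (λ f → f id) inp}
                (fires≤input (AfterNsteps N inp len) i (One-input-AfterNsteps inp one-input))
                (proposition4p11 N id len one-input initial inp)
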